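{- Let $D$ be a finite connected digraph with $\chi(D)=5$ which is not isomorphic to $T_5$ and in which every vertex has out-degree at least $2$. If the underlying graph of $D$ contains a complete graph $K_5$, then $D$ contains a copy of $p_4$.
   Context: A digraph has no loops and, for any two vertices $x,y$, at most one of the arcs $(x,y),(y,x)$. The underlying graph of $D$ is obtained by forgetting orientations; $\chi(D)$ is the chromatic number of the underlying graph. $T_5$ is the tournament on $5$ vertices in which every vertex has in-degree and out-degree $2$ (unique up to isomorphism). $p_4$ is the antidirected path with vertex set $\{x,y,z,v,w\}$ and arcs $y\to x$, $y\to z$, $v\to z$, $v\to w$. "$D$ contains a copy of $H$" means there is an injective map $f:V(H)\to V(D)$ with $(f(a),f(b))$ an arc of $D$ whenever $(a,b)$ is an arc of $H$. -}

module Defs where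

open import Data.Nat using (ℕ; _≤_)
open import Data.Fin using (Fin; zero; suc)
open import Data.Bool using (Bool; true; false)
open import Data.List using (length; filterᵇ; allFin)
open import Data.Product using (Σ; _×_; _,_)
open import Data.Sum using (_⊎_)
open import Relation.Nullary using (¬_)
open import Relation.Binary.PropositionalEquality using (_≡_; _≢_)
open import Function.Bundles using (_⤖_; Bijection)
open import Function.Definitions using (Injective)

record Digraph : Set where
  field
    n      : ℕ
    arc    : Fin n → Fin n → Bool
    noLoop : ∀ x → arc x x ≡ false
    asym   : ∀ x y → arc x y ≡ true → arc y x ≡ false
open Digraph public

Adj : (D : Digraph) → Fin (n D) → Fin (n D) → Set
Adj D u v = (arc D u v ≡ true) ⊎ (arc D v u ≡ true)

Colourable : Digraph → ℕ → Set
Colourable D k = Σ (Fin (n D) → Fin k) λ c → ∀ u v → Adj D u v → c u ≢ c v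

ChromaticNumberIs : Digraph → ℕ → Set
ChromaticNumberIs D k = Colourable D k × (∀ j → Colourable D j → k ≤ j)

data Reachable (D : Digraph) : Fin (n D) → Fin (n D) → Set where
  here : ∀ {u} → Reachable D u u
  step : ∀ {u v w} → Adj D u v → Reachable D v w → Reachable D u w

Connected : Digraph → Set
Connected D = ∀ u v → Reachable D u v

outDegree : (D : Digraph) → Fin (n D) → ℕ
outDegree D v = length (filterᵇ (arc D v) (allFin (n D)))

Isomorphic : Digraph → Digraph → Set
Isomorphic D E = Σ (Fin (n D) ⤖ Fin (n E)) λ f →
  ∀ u v → arc D u v ≡ arc E (Bijection.to f u) (Bijection.to f v)

-- T5: the regular tournament on 5 vertices, i → i+1, i → i+2 (mod 5)
t5arc : Fin 5 → Fin 5 → Bool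
t5arc zero (suc zero) = true
t5arc zero (suc (suc zero)) = true
t5arc (suc zero) (suc (suc zero)) = true
t5arc (suc zero) (suc (suc (suc zero))) = true
t5arc (suc (suc zero)) (suc (suc (suc zero))) = true
t5arc (suc (suc zero)) (suc (suc (suc (suc zero)))) = true
t5arc (suc (suc (suc zero))) (suc (suc (suc (suc zero)))) = true
t5arc (suc (suc (suc zero))) zero = true
t5arc (suc (suc (suc (suc zero)))) zero = true
t5arc (suc (suc (suc (suc zero)))) (suc zero) = true
t5arc _ _ = false

T5 : Digraph
T5 = record
  { n = 5 ; arc = t5arc ; noLoop = nl ; asym = as }
  where
  nl : ∀ x → t5arc x x ≡ false
  nl zero = _≡_.refl
  nl (suc zero) = _≡_.refl
  nl (suc (suc zero)) = _≡_.refl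
  nl (suc (suc (suc zero))) = _≡_.refl
  nl (suc (suc (suc (suc zero)))) = _≡_.refl
  as : ∀ x y → t5arc x y ≡ true → t5arc y x ≡ false
  as zero (suc zero) _ = _≡_.refl
  as zero (suc (suc zero)) _ = _≡_.refl
  as (suc zero) (suc (suc zero)) _ = _≡_.refl
  as (suc zero) (suc (suc (suc zero))) _ = _≡_.refl
  as (suc (suc zero)) (suc (suc (suc zero))) _ = _≡_.refl
  as (suc (suc zero)) (suc (suc (suc (suc zero)))) _ = _≡_.refl
  as (suc (suc (suc zero))) (suc (suc (suc (suc zero)))) _ = _≡_.refl
  as (suc (suc (suc zero))) zero _ = _≡_.refl
  as (suc (suc (suc (suc zero)))) zero _ = _≡_.refl
  as (suc (suc (suc (suc zero)))) (suc zero) _ = _≡_.refl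
  as zero zero ()
  as zero (suc (suc (suc zero))) ()
  as zero (suc (suc (suc (suc zero)))) ()
  as (suc zero) zero ()
  as (suc zero) (suc zero) ()
  as (suc zero) (suc (suc (suc (suc zero)))) ()
  as (suc (suc zero)) zero ()
  as (suc (suc zero)) (suc zero) ()
  as (suc (suc zero)) (suc (suc zero)) ()
  as (suc (suc (suc zero))) (suc zero) ()
  as (suc (suc (suc zero))) (suc (suc zero)) ()
  as (suc (suc (suc zero))) (suc (suc (suc zero))) ()
  as (suc (suc (suc (suc zero)))) (suc (suc zero)) ()
  as (suc (suc (suc (suc zero)))) (suc (suc (suc zero))) ()
  as (suc (suc (suc (suc zero)))) (suc (suc (suc (suc zero)))) ()

ContainsK5 : Digraph → Set
ContainsK5 D = Σ (Fin 5 → Fin (n D)) λ f →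
  Injective _≡_ _≡_ f × (∀ i j → i ≢ j → Adj D (f i) (f j))

ContainsP4 : Digraph → Set
ContainsP4 D = Σ (Fin 5 → Fin (n D)) λ f →
  Injective _≡_ _≡_ f ×
  (arc D (f y) (f x) ≡ true) × (arc D (f y) (f z) ≡ true) ×
  (arc D (f v) (f z) ≡ true) × (arc D (f v) (f w) ≡ true)
  where
  x y z v w : Fin 5
  x = zero
  y = suc zero
  z = suc (suc zero)
  v = suc (suc (suc zero))
  w = suc (suc (suc (suc zero)))

-- The five vertices of the K5 span a tournament, and an exhaustive check shows that every
-- tournament on five vertices contains p4 unless it is T5. In the remaining case D is not T5
-- itself, so by connectivity some vertex c outside the T5 is adjacent to a vertex s of it.
-- If s → c, then T5 + c already contains p4. Otherwise c → s, and c has a second out-neighbour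
-- w; whether w lies in the T5 or not, the digraph formed by T5, c and w contains p4, again by
-- an exhaustive check.
module Submission where

open import Defs
open import Data.Bool using (Bool; true; false; not; _∨_; T?)
import Data.Bool as Bool
open import Data.Bool.Properties using (T-≡)
open import Data.Fin using (Fin; zero; suc; #_; _≟_; punchIn)
open import Data.Fin.Properties
  using (all?; any?; ¬∀⟶∃¬; suc-injective; punchIn-injective; punchInᵢ≢i)
open import Data.List using (List; _∷_; []; [_]; concatMap; map; allFin; length)
open import Data.List.Membership.Propositional using (_∈_; find)
open import Data.List.Membership.Propositional.Properties using (∈-concatMap⁻; ∈-map⁻; ∈-filter⁻)
open import Data.List.Relation.Unary.All using (_∷_)
open import Data.List.Relation.Unary.AllPairs using (_∷_)
open import Data.List.Relation.Unary.Any using (Any; here; there; satisfied)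
import Data.List.Relation.Unary.Any as Any
open import Data.List.Relation.Unary.Unique.Propositional using (Unique)
import Data.List.Relation.Unary.Unique.Propositional.Properties as Unique
open import Data.Nat using (ℕ; zero; suc; _≤_; s≤s)
open import Data.Product using (Σ; ∃; ∃₂; _×_; _,_; proj₁; proj₂)
open import Data.Sum using (_⊎_; inj₁; inj₂)
open import Data.Unit using (⊤; tt)
open import Data.Vec using (Vec; []; _∷_; lookup; tabulate)
open import Data.Vec.Properties using (lookup∘tabulate)
import Data.Vec.Functional as Vector
open import Function using (_∘_; const; id)
open import Function.Bundles using (mk⤖; Equivalence)
open import Function.Definitions using (Injective)
open import Relation.Nullary using (¬_; Dec; yes; no; contradiction)
open import Relation.Nullary.Decidable using (_×-dec_; _⊎-dec_; _→-dec_; map′; toWitness; ¬?; ⌊_⌋)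
open import Relation.Unary using (Decidable)
open import Relation.Binary.Definitions using (DecidableEquality)
open import Relation.Binary.PropositionalEquality using (_≡_; _≢_; refl; sym; trans; cong; cong₂)

private
  variable
    k l m : ℕ

Arcs : ℕ → Set
Arcs m = Fin m → Fin m → Bool

IsP4 : Arcs m → (Fin 5 → Fin m) → Set
IsP4 A f = (A (f (# 1)) (f (# 0)) ≡ true) × (A (f (# 1)) (f (# 2)) ≡ true) ×
           (A (f (# 3)) (f (# 2)) ≡ true) × (A (f (# 3)) (f (# 4)) ≡ true)

-- HasP4 (arc D) unfolds to ContainsP4 D.
HasP4 : Arcs m → Set
HasP4 {m} A = Σ (Fin 5 → Fin m) λ f → Injective _≡_ _≡_ f × IsP4 A f

record _↪_ (A : Arcs m) (B : Arcs k) : Set where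
  field
    embed     : Fin m → Fin k
    injective : Injective _≡_ _≡_ embed
    arcs      : ∀ i j → A i j ≡ true → B (embed i) (embed j) ≡ true
open _↪_

record _↪ᵢ_ (A : Arcs m) (B : Arcs k) : Set where
  field
    embed     : Fin m → Fin k
    injective : Injective _≡_ _≡_ embed
    arcs-≡    : ∀ i j → B (embed i) (embed j) ≡ A i j
open _↪ᵢ_

↪ᵢ⇒↪ : {A : Arcs m} {B : Arcs k} → A ↪ᵢ B → A ↪ B
↪ᵢ⇒↪ e = record
  { embed = embed e ; injective = injective e ; arcs = λ i j a → trans (arcs-≡ e i j) a }

↪ᵢ-trans : {A : Arcs m} {B : Arcs k} {C : Arcs l} → A ↪ᵢ B → B ↪ᵢ C → A ↪ᵢ C
↪ᵢ-trans e e′ = record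
  { embed     = embed e′ ∘ embed e
  ; injective = injective e ∘ injective e′
  ; arcs-≡    = λ i j → trans (arcs-≡ e′ (embed e i) (embed e j)) (arcs-≡ e i j) }

HasP4-↪ : {A : Arcs m} {B : Arcs k} → A ↪ B → HasP4 A → HasP4 B
HasP4-↪ e (f , f-inj , a₁ , a₂ , a₃ , a₄) =
  embed e ∘ f , f-inj ∘ injective e ,
  arcs e _ _ a₁ , arcs e _ _ a₂ , arcs e _ _ a₃ , arcs e _ _ a₄

∈-image? : {A : Arcs m} {B : Arcs k} (e : A ↪ᵢ B) → Decidable λ v → ∃ λ i → embed e i ≡ v
∈-image? e v = any? λ i → embed e i ≟ v

addVertex : (N⁺ N⁻ : Fin m → Bool) → Arcs m → Arcs (suc m)
addVertex N⁺ N⁻ A zero    zero    = false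
addVertex N⁺ N⁻ A zero    (suc j) = N⁺ j
addVertex N⁺ N⁻ A (suc i) zero    = N⁻ i
addVertex N⁺ N⁻ A (suc i) (suc j) = A i j

∷-injective : {A : Set} {c : A} {f : Fin m → A} → Injective _≡_ _≡_ f →
              (∀ i → f i ≢ c) → Injective _≡_ _≡_ (c Vector.∷ f)
∷-injective f-inj c∉f {zero}  {zero}  _  = refl
∷-injective f-inj c∉f {zero}  {suc j} eq = contradiction (sym eq) (c∉f j)
∷-injective f-inj c∉f {suc i} {zero}  eq = contradiction eq (c∉f i)
∷-injective f-inj c∉f {suc i} {suc j} eq = cong suc (f-inj eq)

addVertex-↪ : {A : Arcs m} {B : Arcs k} {N⁺ N⁻ : Fin m → Bool} {c : Fin k} →
              (e : A ↪ B) → (∀ i → embed e i ≢ c) →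
              (∀ i → N⁺ i ≡ true → B c (embed e i) ≡ true) →
              (∀ i → N⁻ i ≡ true → B (embed e i) c ≡ true) →
              addVertex N⁺ N⁻ A ↪ B
addVertex-↪ {c = c} e c∉e out in′ = record
  { embed     = c Vector.∷ embed e
  ; injective = ∷-injective (injective e) c∉e
  ; arcs      = λ where
      zero    zero    ()
      zero    (suc j) → out j
      (suc i) zero    → in′ i
      (suc i) (suc j) → arcs e i j }

only : Fin m → Fin m → Bool
only s i = ⌊ i ≟ s ⌋

only-elim : {P : Fin m → Set} {s : Fin m} → P s → ∀ i → only s i ≡ true → P i
only-elim {s = s} Ps i _ with i ≟ s
... | yes refl = Ps

only₂-elim : {P : Fin m → Set} {s t : Fin m} → P s → P t → ∀ i → only s i ∨ only t i ≡ true → P i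
only₂-elim {s = s} {t} Ps Pt i _ with i ≟ s | i ≟ t
... | yes refl | _        = Ps
... | no _     | yes refl = Pt

injections : ∀ k m → List (Fin k → Fin m)
injections zero    m       = [ (λ ()) ]
injections (suc k) zero    = []
injections (suc k) (suc m) = concatMap (λ i → map (i ∷punchIn_) (injections k m)) (allFin (suc m))
  where
  _∷punchIn_ : Fin (suc m) → (Fin k → Fin m) → Fin (suc k) → Fin (suc m)
  i ∷punchIn f = i Vector.∷ (punchIn i ∘ f)

∈-injections⇒injective : {f : Fin k → Fin m} → f ∈ injections k m → Injective _≡_ _≡_ f
∈-injections⇒injective {zero}  {m}     _ {()}
∈-injections⇒injective {suc k} {suc m} f∈ with satisfied (∈-concatMap⁻ _ {allFin (suc m)} f∈)
... | i , f∈′ with ∈-map⁻ _ f∈′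
... | g , g∈ , refl =
  ∷-injective (∈-injections⇒injective g∈ ∘ punchIn-injective i _ _) (λ j → punchInᵢ≢i i (g j))

Any-injections⇒∃ : ∀ {k m} {P : (Fin k → Fin m) → Set} → Any P (injections k m) →
                   Σ (Fin k → Fin m) λ f → Injective _≡_ _≡_ f × P f
Any-injections⇒∃ p with find p
... | f , f∈ , pf = f , ∈-injections⇒injective f∈ , pf

IsP4? : (A : Arcs m) → Decidable (IsP4 A)
IsP4? A f = (A (f (# 1)) (f (# 0)) Bool.≟ true) ×-dec (A (f (# 1)) (f (# 2)) Bool.≟ true) ×-dec
            (A (f (# 3)) (f (# 2)) Bool.≟ true) ×-dec (A (f (# 3)) (f (# 4)) Bool.≟ true)

searchP4 : (A : Arcs m) → Dec (Any (IsP4 A) (injections 5 m))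
searchP4 {m} A = Any.any? (IsP4? A) (injections 5 m)

IsT5Copy : Arcs 5 → (Fin 5 → Fin 5) → Set
IsT5Copy T f = ∀ i j → T (f i) (f j) ≡ t5arc i j

searchT5 : (T : Arcs 5) → Dec (Any (IsT5Copy T) (injections 5 5))
searchT5 T = Any.any? (λ f → all? λ i → all? λ j → T (f i) (f j) Bool.≟ t5arc i j) (injections 5 5)

IsTournament : Arcs m → Set
IsTournament T = (∀ i → T i i ≡ false) × (∀ i j → i ≢ j → T j i ≡ not (T i j))

-- The orientations of the arcs at vertex 0, then recursively those of the rest.
Orientation : ℕ → Set
Orientation zero    = ⊤
Orientation (suc m) = Vec Bool m × Orientation m

tournament : Orientation m → Arcs m
tournament {zero}  _       ()
tournament {suc m} (o , t) = addVertex (lookup o) (not ∘ lookup o) (tournament t)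

orientation : Arcs m → Orientation m
orientation {zero}  T = tt
orientation {suc m} T = tabulate (T zero ∘ suc) , orientation (λ i j → T (suc i) (suc j))

tournament-orientation : {T : Arcs m} → IsTournament T →
                         ∀ i j → T i j ≡ tournament (orientation T) i j
tournament-orientation (loopless , _) zero zero = loopless zero
tournament-orientation {T = T} _ zero (suc j) = sym (lookup∘tabulate (T zero ∘ suc) j)
tournament-orientation {T = T} (_ , flip) (suc i) zero =
  trans (flip zero (suc i) λ ()) (cong not (sym (lookup∘tabulate (T zero ∘ suc) i)))
tournament-orientation (loopless , flip) (suc i) (suc j) =
  tournament-orientation (loopless ∘ suc , λ i j i≢j → flip (suc i) (suc j) (i≢j ∘ suc-injective))
                         i j

orientation-↪ᵢ : {T : Arcs m} → IsTournament T → tournament (orientation T) ↪ᵢ T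
orientation-↪ᵢ T-tour =
  record { embed = id ; injective = id ; arcs-≡ = tournament-orientation T-tour }

all-Vec? : {P : Vec Bool m → Set} → (∀ v → Dec (P v)) → Dec (∀ v → P v)
all-Vec? {zero}  P? = map′ (λ p → λ { [] → p }) (λ h → h []) (P? [])
all-Vec? {suc m} P? = map′ (λ (t , f) → λ { (true ∷ v) → t v ; (false ∷ v) → f v })
                           (λ h → (λ v → h (true ∷ v)) , (λ v → h (false ∷ v)))
                           (all-Vec? (P? ∘ (true ∷_)) ×-dec all-Vec? (P? ∘ (false ∷_)))

all-Orientation? : {P : Orientation m → Set} → (∀ t → Dec (P t)) → Dec (∀ t → P t)
all-Orientation? {zero}  P? = map′ (λ p _ → p) (λ h → h tt) (P? tt)
all-Orientation? {suc m} P? = map′ (λ h (o , t) → h o t) (λ h o t → h (o , t))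
                                   (all-Vec? λ o → all-Orientation? λ t → P? (o , t))

T5-with-in-arc : Fin 5 → Arcs 6
T5-with-in-arc s = addVertex (const false) (only s) t5arc

T5-with-out-arcs : Fin 5 → Fin 5 → Arcs 6
T5-with-out-arcs s t = addVertex (λ i → only s i ∨ only t i) (const false) t5arc

-- T5 plus vertices w = 0, c = 1 and the arcs c → s, c → w.
T5-with-out-arc-and-pendant : Fin 5 → Arcs 7
T5-with-out-arc-and-pendant s =
  addVertex (const false) (only zero) (addVertex (only s) (const false) t5arc)

-- Opaque, so that the searches are not re-run when these facts are applied to open terms.
opaque
  orientation₅-P4-or-T5 : ∀ t → Any (IsP4 (tournament t)) (injections 5 5) ⊎
                                Any (IsT5Copy (tournament t)) (injections 5 5)
  orientation₅-P4-or-T5 =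
    toWitness {a? = all-Orientation? λ t → searchP4 (tournament t) ⊎-dec searchT5 (tournament t)} _

  T5-with-in-arc-HasP4 : ∀ s → HasP4 (T5-with-in-arc s)
  T5-with-in-arc-HasP4 = Any-injections⇒∃ ∘ toWitness {a? = all? (searchP4 ∘ T5-with-in-arc)} _

  T5-with-out-arcs-HasP4 : ∀ s t → s ≢ t → HasP4 (T5-with-out-arcs s t)
  T5-with-out-arcs-HasP4 s t s≢t =
    Any-injections⇒∃ (toWitness {a? = all? λ s → all? λ t →
                                      ¬? (s ≟ t) →-dec searchP4 (T5-with-out-arcs s t)} _ s t s≢t)

  T5-with-out-arc-and-pendant-HasP4 : ∀ s → HasP4 (T5-with-out-arc-and-pendant s)
  T5-with-out-arc-and-pendant-HasP4 =
    Any-injections⇒∃ ∘ toWitness {a? = all? (searchP4 ∘ T5-with-out-arc-and-pendant)} _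

tournament₅-HasP4-or-T5 : (T : Arcs 5) → IsTournament T → HasP4 T ⊎ t5arc ↪ᵢ T
tournament₅-HasP4-or-T5 T T-tour with orientation₅-P4-or-T5 (orientation T)
... | inj₁ p4 = inj₁ (HasP4-↪ (↪ᵢ⇒↪ (orientation-↪ᵢ T-tour)) (Any-injections⇒∃ p4))
... | inj₂ t5 with Any-injections⇒∃ t5
...   | f , f-inj , f-t5 =
  inj₂ (↪ᵢ-trans (record { embed = f ; injective = f-inj ; arcs-≡ = f-t5 }) (orientation-↪ᵢ T-tour))

induced : (D : Digraph) → (Fin m → Fin (n D)) → Arcs m
induced D f i j = arc D (f i) (f j)

induced-↪ᵢ : (D : Digraph) {f : Fin m → Fin (n D)} → Injective _≡_ _≡_ f → induced D f ↪ᵢ arc D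
induced-↪ᵢ D {f} f-inj = record { embed = f ; injective = f-inj ; arcs-≡ = λ _ _ → refl }

Adj-flip : (D : Digraph) {a b : Fin (n D)} → Adj D a b → arc D b a ≡ not (arc D a b)
Adj-flip D {a} {b} (inj₁ a→b) = trans (asym D a b a→b) (cong not (sym a→b))
Adj-flip D {a} {b} (inj₂ b→a) = trans b→a (cong not (sym (asym D b a b→a)))

clique-IsTournament : (D : Digraph) {f : Fin m → Fin (n D)} →
                      (∀ i j → i ≢ j → Adj D (f i) (f j)) → IsTournament (induced D f)
clique-IsTournament D {f} f-adj = (λ i → noLoop D (f i)) , (λ i j i≢j → Adj-flip D (f-adj i j i≢j))

∃-∈-≢ : {A : Set} → DecidableEquality A → {xs : List A} → Unique xs → 2 ≤ length xs →
        ∀ c → ∃ λ x → x ∈ xs × x ≢ c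
∃-∈-≢ _≟_ {x ∷ y ∷ _} ((x≢y ∷ _) ∷ _) _ c with x ≟ c
... | no x≢c   = x , here refl , x≢c
... | yes refl = y , there (here refl) , x≢y ∘ sym
∃-∈-≢ _ {[]}     _ ()       _
∃-∈-≢ _ {_ ∷ []} _ (s≤s ()) _

second-out-neighbour : (D : Digraph) {u : Fin (n D)} → 2 ≤ outDegree D u →
                       ∀ c → ∃ λ w → w ≢ c × arc D u w ≡ true
second-out-neighbour D {u} deg c
  with ∃-∈-≢ _≟_ (Unique.filter⁺ (T? ∘ arc D u) (Unique.allFin⁺ (n D))) deg c
... | w , w∈ , w≢c =
  w , w≢c , Equivalence.to T-≡ (proj₂ (∈-filter⁻ (T? ∘ arc D u) {xs = allFin (n D)} w∈))

crossing-edge : (D : Digraph) {P : Fin (n D) → Set} → Decidable P → {a b : Fin (n D)} →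
                Reachable D a b → ¬ P a → P b → ∃₂ λ c d → ¬ P c × P d × Adj D c d
crossing-edge D P? here                 ¬Pa Pb = contradiction Pb ¬Pa
crossing-edge D P? (step {v = v} adj r) ¬Pa Pb with P? v
... | yes Pv  = _ , v , ¬Pa , Pv , adj
... | no  ¬Pv = crossing-edge D P? r ¬Pv Pb

↪ᵢ-onto⇒Isomorphic : (E D : Digraph) (e : arc E ↪ᵢ arc D) → (∀ v → ∃ λ i → embed e i ≡ v) →
                     Isomorphic D E
↪ᵢ-onto⇒Isomorphic E D e onto = mk⤖ {to = h} (h-inj , λ i → embed e i , h∘embed i) , arcs-h
  where
  h : Fin (n D) → Fin (n E)
  h v = proj₁ (onto v)
  embed∘h : ∀ v → embed e (h v) ≡ v
  embed∘h v = proj₂ (onto v)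
  h-inj : Injective _≡_ _≡_ h
  h-inj {u} {v} eq = trans (sym (embed∘h u)) (trans (cong (embed e) eq) (embed∘h v))
  h∘embed : ∀ i {v} → v ≡ embed e i → h v ≡ i
  h∘embed i refl = injective e (embed∘h (embed e i))
  arcs-h : ∀ u v → arc D u v ≡ arc E (h u) (h v)
  arcs-h u v = trans (sym (cong₂ (arc D) (embed∘h u) (embed∘h v))) (arcs-≡ e (h u) (h v))

T5-neighbour⇒ContainsP4 : (D : Digraph) (e : t5arc ↪ᵢ arc D) → (∀ u → 2 ≤ outDegree D u) →
                          {c : Fin (n D)} {s : Fin 5} → (∀ i → embed e i ≢ c) →
                          Adj D c (embed e s) → ContainsP4 D
T5-neighbour⇒ContainsP4 D e _ {c} {s} c∉e (inj₂ s→c) =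
  HasP4-↪ (addVertex-↪ (↪ᵢ⇒↪ e) c∉e (λ _ ()) (only-elim s→c)) (T5-with-in-arc-HasP4 s)
T5-neighbour⇒ContainsP4 D e outdeg {c} {s} c∉e (inj₁ c→s)
  with second-out-neighbour D (outdeg c) (embed e s)
... | w , w≢s , c→w with ∈-image? e w
...   | yes (t , refl) =
  HasP4-↪ (addVertex-↪ (↪ᵢ⇒↪ e) c∉e (only₂-elim c→s c→w) (λ _ ()))
          (T5-with-out-arcs-HasP4 s t λ { refl → w≢s refl })
...   | no w∉e =
  HasP4-↪ (addVertex-↪ (addVertex-↪ (↪ᵢ⇒↪ e) c∉e (only-elim c→s) (λ _ ()))
                       w∉c∷e (λ _ ()) (only-elim c→w))
          (T5-with-out-arc-and-pendant-HasP4 s)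
  where
  w∉c∷e : ∀ i → (c Vector.∷ embed e) i ≢ w
  w∉c∷e zero    refl = contradiction (trans (sym c→w) (noLoop D c)) λ ()
  w∉c∷e (suc i) eq   = w∉e (i , eq)

T5-copy⇒ContainsP4 : (D : Digraph) → t5arc ↪ᵢ arc D → Connected D → ¬ Isomorphic D T5 →
                     (∀ u → 2 ≤ outDegree D u) → ContainsP4 D
T5-copy⇒ContainsP4 D e conn ¬iso outdeg with all? (∈-image? e)
... | yes onto = contradiction (↪ᵢ-onto⇒Isomorphic T5 D e onto) ¬iso
... | no ¬onto with ¬∀⟶∃¬ _ _ (∈-image? e) ¬onto
...   | u , u∉e with crossing-edge D (∈-image? e) (conn u (embed e zero)) u∉e (zero , refl)
...     | c , _ , c∉e , (s , refl) , c~s =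
  T5-neighbour⇒ContainsP4 D e outdeg (λ i eq → c∉e (i , eq)) c~s

corollary2p3 : (D : Digraph) → Connected D → ChromaticNumberIs D 5 →
    ¬ Isomorphic D T5 → (∀ u → 2 ≤ outDegree D u) → ContainsK5 D → ContainsP4 D
corollary2p3 D conn _ ¬iso outdeg (f , f-inj , f-adj)
  with tournament₅-HasP4-or-T5 (induced D f) (clique-IsTournament D f-adj)
... | inj₁ p4 = HasP4-↪ (↪ᵢ⇒↪ (induced-↪ᵢ D f-inj)) p4
... | inj₂ t5 = T5-copy⇒ContainsP4 D (↪ᵢ-trans t5 (induced-↪ᵢ D f-inj)) conn ¬iso outdeg
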